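{- Let $G$ be a connected graph with exactly one cycle $C$, of odd length. Let $S\subseteq V(G)$ be such that for every $u\in V(C)$, $S$ is not a subset of $V(T_u)$. Then $S$ resolves $V(C)$: for all distinct $x,y\in V(C)$ there is $s\in S$ with $d(s,x)\neq d(s,y)$.
   Context: For $u\in V(C)$, $T_u$ denotes the connected component containing $u$ of the graph $(V(G),E(G)\setminus E(C))$. $d$ is the shortest-path distance in $G$. -}

module Defs where

open import Data.Nat using (ℕ; zero; suc; _+_; _*_; _<_; _≤_)
open import Data.Fin using (Fin; toℕ)
open import Data.Fin.Subset using (Subset; _∈_)
open import Data.Product using (Σ; ∃; ∃-syntax; _×_; _,_)
open import Data.Sum using (_⊎_)
open import Relation.Nullary using (¬_)
open import Relation.Binary using (Decidable)
open import Relation.Binary.PropositionalEquality using (_≡_; _≢_)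
open import Function.Definitions using (Injective)

record Graph (n : ℕ) : Set₁ where
  field
    Adj     : Fin n → Fin n → Set
    adj?    : Decidable Adj
    symAdj  : ∀ {u v} → Adj u v → Adj v u
    irrefl  : ∀ {u} → ¬ Adj u u
open Graph public

data Walk {n : ℕ} (E : Fin n → Fin n → Set) : Fin n → Fin n → ℕ → Set where
  here : ∀ {u} → Walk E u u zero
  step : ∀ {u v w k} → E u v → Walk E v w k → Walk E u w (suc k)

Connected : ∀ {n} → Graph n → Set
Connected {n} G = ∀ (u v : Fin n) → ∃[ k ] Walk (Adj G) u v k

Dist : ∀ {n} → Graph n → Fin n → Fin n → ℕ → Set
Dist G u v k = Walk (Adj G) u v k × (∀ l → Walk (Adj G) u v l → k ≤ l)

-- A cycle of length k = suc m ≥ 3: distinct vertices c 0, …, c m,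
-- with c i ~ c (i+1) and c m ~ c 0.
Consec : ∀ {m} → Fin (suc m) → Fin (suc m) → Set
Consec {m} i j = (toℕ j ≡ suc (toℕ i)) ⊎ (toℕ i ≡ m × toℕ j ≡ 0)

record Cycle {n : ℕ} (G : Graph n) : Set where
  field
    len-1   : ℕ
    len≥3   : 2 ≤ len-1
    vert    : Fin (suc len-1) → Fin n
    inj     : Injective _≡_ _≡_ vert
    adjC    : ∀ i j → Consec i j → Adj G (vert i) (vert j)
open Cycle public

cycleLength : ∀ {n} {G : Graph n} → Cycle G → ℕ
cycleLength C = suc (len-1 C)

OnCycle : ∀ {n} {G : Graph n} → Cycle G → Fin n → Set
OnCycle C x = ∃[ i ] x ≡ vert C i

CycleEdge : ∀ {n} {G : Graph n} → Cycle G → Fin n → Fin n → Set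
CycleEdge C u v = ∃[ i ] ∃[ j ] Consec i j ×
  ((u ≡ vert C i × v ≡ vert C j) ⊎ (u ≡ vert C j × v ≡ vert C i))

-- Two cycles are the same subgraph iff they have the same edge set.
SameCycle : ∀ {n} {G : Graph n} → Cycle G → Cycle G → Set
SameCycle C D = ∀ u v → (CycleEdge C u v → CycleEdge D u v) × (CycleEdge D u v → CycleEdge C u v)

UniqueCycle : ∀ {n} {G : Graph n} → Cycle G → Set
UniqueCycle {G = G} C = ∀ (D : Cycle G) → SameCycle C D

Odd : ℕ → Set
Odd k = ∃[ t ] k ≡ suc (t * 2)

AdjMinusC : ∀ {n} {G : Graph n} → Cycle G → Fin n → Fin n → Set
AdjMinusC {G = G} C u v = Adj G u v × ¬ CycleEdge C u v

-- w ∈ V(T_u): w is in the component of u in (V(G), E(G) ∖ E(C))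
InT : ∀ {n} {G : Graph n} → Cycle G → Fin n → Fin n → Set
InT C u w = ∃[ k ] Walk (AdjMinusC C) u w k

-- Each vertex s lies in exactly one of the trees T_c, c on the cycle: a walk
-- avoiding E(C) between two cycle vertices would close up with an arc of C into
-- a second cycle. A walk from s to a cycle vertex leaves T_c only through c, so
-- d(s, x) = d(s, c) + d_C(c, x). If no s ∈ S distinguished x = c_i from y = c_j,
-- the root c_a of every vertex of S would satisfy d_C(a, i) = d_C(a, j), hence
-- 2a ≡ i + j modulo the cycle length. As that length is odd, a is the same for
-- all of S, so S lies in a single tree T_(c_a).
module Submission where

open import Defs
open import Data.Empty using (⊥; ⊥-elim)
open import Data.Fin using (Fin; _≟_; toℕ; fromℕ<) renaming (zero to fzero; suc to fsuc)
open import Data.Fin.Properties using (any?; toℕ<n; toℕ-injective; toℕ-fromℕ<)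
open import Data.Fin.Subset using (Subset; _∈_)
open import Data.Fin.Subset.Properties using (_∈?_)
open import Data.List.Base using (List; []; _∷_; _++_; length; lookup; applyUpTo)
open import Data.List.Membership.Propositional using (lose) renaming (_∈_ to _∈ₗ_)
open import Data.List.Membership.Propositional.Properties
  using (∈-∃++; ∈-lookup; ∈-applyUpTo⁻; ∈-++⁺ʳ; ∈-length)
open import Data.List.Relation.Binary.Disjoint.Propositional using (Disjoint)
open import Data.List.Relation.Unary.All using (All; []; _∷_)
import Data.List.Relation.Unary.All as All
open import Data.List.Relation.Unary.All.Properties using (¬Any⇒All¬)
import Data.List.Relation.Unary.All.Properties as All
open import Data.List.Relation.Unary.Any using (Any; here; there)
import Data.List.Relation.Unary.First as First
open import Data.List.Relation.Unary.First.Properties using (toView)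
open import Data.List.Relation.Unary.Linked using (Linked; []; [-]; _∷_)
import Data.List.Relation.Unary.Linked as Linked
import Data.List.Relation.Unary.Linked.Properties as Linked
open import Data.List.Relation.Unary.Unique.Propositional using (Unique; []; _∷_)
import Data.List.Relation.Unary.Unique.Propositional.Properties as Unique
open import Data.Nat using (ℕ; zero; suc; _+_; _*_; _∸_; _⊓_; _≤_; _<_; _<?_; z≤n; s≤s)
open import Data.Nat.DivMod using (_%_; _/_; m≡m%n+[m/n]*n; m%n<n)
open import Data.Nat.Properties renaming (_≟_ to _≟ℕ_)
open import Data.Nat.Tactic.RingSolver using (solve)
open import Data.Product using (∃; ∃-syntax; _×_; _,_; proj₁; proj₂)
open import Data.Sum using (_⊎_; inj₁; inj₂)
open import Function.Base using (_∘_; _∋_)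
open import Level using (0ℓ)
open import Relation.Binary.Bundles using (Setoid)
open import Relation.Binary.PropositionalEquality
import Relation.Binary.Reasoning.Setoid as SetoidReasoning
open import Relation.Nullary using (¬_; Dec; yes; no)
open import Relation.Nullary.Decidable using (_×-dec_; _⊎-dec_; toSum; ¬?; decidable-stable)
open import Relation.Unary using (Pred)
import Relation.Unary as U

module Modular (M : ℕ) where

  -- congruence modulo M, phrased additively so that no truncated subtraction occurs
  infix 4 _≈_
  _≈_ : ℕ → ℕ → Set
  x ≈ y = ∃[ e ] ∃[ e′ ] x + e * M ≡ y + e′ * M

  ≈-reflexive : ∀ {x y} → x ≡ y → x ≈ y
  ≈-reflexive x≡y = 0 , 0 , cong (_+ 0) x≡y

  ≈-refl : ∀ {x} → x ≈ x
  ≈-refl = ≈-reflexive refl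

  ≈-sym : ∀ {x y} → x ≈ y → y ≈ x
  ≈-sym (e , e′ , eq) = e′ , e , sym eq

  -- The annotation List ℕ ∋ … in the solver calls resolves the overloaded _∷_;
  -- without it, elaborating the solver's argument is extremely slow.
  ≈-trans : ∀ {x y z} → x ≈ y → y ≈ z → x ≈ z
  ≈-trans {x} {y} {z} (e , e′ , p) (f , f′ , q) = e + f , f′ + e′ , (begin
    x + (e + f) * M       ≡⟨ solve (List ℕ ∋ x ∷ e ∷ f ∷ M ∷ []) ⟩
    (x + e * M) + f * M   ≡⟨ cong (_+ f * M) p ⟩
    (y + e′ * M) + f * M  ≡⟨ solve (List ℕ ∋ y ∷ e′ ∷ f ∷ M ∷ []) ⟩
    (y + f * M) + e′ * M  ≡⟨ cong (_+ e′ * M) q ⟩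
    (z + f′ * M) + e′ * M ≡⟨ solve (List ℕ ∋ z ∷ f′ ∷ e′ ∷ M ∷ []) ⟩
    z + (f′ + e′) * M    ∎)
    where open ≡-Reasoning

  ≈-setoid : Setoid 0ℓ 0ℓ
  ≈-setoid = record
    { Carrier = ℕ
    ; _≈_ = _≈_
    ; isEquivalence = record { refl = ≈-refl ; sym = ≈-sym ; trans = ≈-trans }
    }

  module ≈-Reasoning = SetoidReasoning ≈-setoid

  +-cong : ∀ {a b c d} → a ≈ b → c ≈ d → a + c ≈ b + d
  +-cong {a} {b} {c} {d} (e , e′ , p) (f , f′ , q) = e + f , e′ + f′ , (begin
    (a + c) + (e + f) * M       ≡⟨ solve (List ℕ ∋ a ∷ c ∷ e ∷ f ∷ M ∷ []) ⟩
    (a + e * M) + (c + f * M)   ≡⟨ cong₂ _+_ p q ⟩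
    (b + e′ * M) + (d + f′ * M) ≡⟨ solve (List ℕ ∋ b ∷ d ∷ e′ ∷ f′ ∷ M ∷ []) ⟩
    (b + d) + (e′ + f′) * M     ∎)
    where open ≡-Reasoning

  +-congˡ : ∀ {a b c} → b ≈ c → a + b ≈ a + c
  +-congˡ = +-cong ≈-refl

  +-cancelʳ : ∀ {a b c} → a + c ≈ b + c → a ≈ b
  +-cancelʳ {a} {b} {c} (e , e′ , p) = e , e′ , +-cancelʳ-≡ c _ _ (begin
    (a + e * M) + c  ≡⟨ solve (List ℕ ∋ a ∷ e ∷ c ∷ M ∷ []) ⟩
    (a + c) + e * M  ≡⟨ p ⟩
    (b + c) + e′ * M ≡⟨ solve (List ℕ ∋ b ∷ e′ ∷ c ∷ M ∷ []) ⟩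
    (b + e′ * M) + c ∎)
    where open ≡-Reasoning

  +-cancelˡ : ∀ {a b c} → c + a ≈ c + b → a ≈ b
  +-cancelˡ {a} {b} {c} = +-cancelʳ ∘ subst₂ _≈_ (+-comm c a) (+-comm c b)

  x+M≈x : ∀ x → x + M ≈ x
  x+M≈x x = 0 , 1 , solve (List ℕ ∋ x ∷ M ∷ [])

  private
    midpoint : ∀ {t x y a} → t + x ≈ a → t + a ≈ y → a + a ≈ x + y
    midpoint {t} {x} {y} {a} t+x≈a t+a≈y = begin
      a + a     ≈⟨ +-cong t+x≈a ≈-refl ⟨
      t + x + a ≡⟨ solve (List ℕ ∋ t ∷ x ∷ a ∷ []) ⟩
      t + a + x ≈⟨ +-cong t+a≈y ≈-refl ⟩
      y + x     ≡⟨ +-comm y x ⟩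
      x + y     ∎
      where open ≈-Reasoning

  ≈-midpoint : ∀ {t x y a} → (t + x ≈ a ⊎ t + a ≈ x) → (t + y ≈ a ⊎ t + a ≈ y) → ¬ x ≈ y →
               a + a ≈ x + y
  ≈-midpoint (inj₁ x→a) (inj₁ y→a) x≉y = ⊥-elim (x≉y (+-cancelˡ (≈-trans x→a (≈-sym y→a))))
  ≈-midpoint (inj₁ x→a) (inj₂ a→y) _   = midpoint x→a a→y
  ≈-midpoint {x = x} {y} (inj₂ a→x) (inj₁ y→a) _ =
    ≈-trans (midpoint y→a a→x) (≈-reflexive (+-comm y x))
  ≈-midpoint (inj₂ a→x) (inj₂ a→y) x≉y = ⊥-elim (x≉y (≈-trans (≈-sym a→x) a→y))

  ≈⇒offset : ∀ {x y} → x ≈ y → ∃[ k ] (y ≡ x + k * M ⊎ x ≡ y + k * M)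
  ≈⇒offset (e , e′ , p) = offset e e′ p
    where
    offset : ∀ {x y} e e′ → x + e * M ≡ y + e′ * M → ∃[ k ] (y ≡ x + k * M ⊎ x ≡ y + k * M)
    offset {x} zero e′ p = e′ , inj₂ (trans (sym (+-identityʳ x)) p)
    offset {y = y} (suc e) zero p = suc e , inj₁ (trans (sym (+-identityʳ y)) (sym p))
    offset {x} {y} (suc e) (suc e′) p = offset e e′ (+-cancelˡ-≡ M _ _ (begin
      M + (x + e * M)  ≡⟨ solve (List ℕ ∋ x ∷ e ∷ M ∷ []) ⟩
      x + suc e * M    ≡⟨ p ⟩
      y + suc e′ * M   ≡⟨ solve (List ℕ ∋ y ∷ e′ ∷ M ∷ []) ⟩
      M + (y + e′ * M) ∎))
      where open ≡-Reasoning

  private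
    M≤x+[1+k]*M : ∀ x k → M ≤ x + suc k * M
    M≤x+[1+k]*M x k = ≤-trans (m≤m+n M (k * M)) (m≤n+m (suc k * M) x)

  ≈⇒≡ : ∀ {x y} → x ≈ y → x < M → y < M → x ≡ y
  ≈⇒≡ {x} {y} x≈y x<M y<M with ≈⇒offset x≈y
  ... | zero  , inj₁ eq = sym (trans eq (+-identityʳ x))
  ... | zero  , inj₂ eq = trans eq (+-identityʳ y)
  ... | suc k , inj₁ eq = ⊥-elim (<⇒≱ y<M (subst (M ≤_) (sym eq) (M≤x+[1+k]*M x k)))
  ... | suc k , inj₂ eq = ⊥-elim (<⇒≱ x<M (subst (M ≤_) (sym eq) (M≤x+[1+k]*M y k)))

  +-self-injective : ∀ {a b} → a + a ≡ b + b → a ≡ b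
  +-self-injective {a} {b} eq = *-cancelˡ-≡ a b 2 (begin
    2 * a ≡⟨ solve (List ℕ ∋ a ∷ []) ⟩
    a + a ≡⟨ eq ⟩
    b + b ≡⟨ solve (List ℕ ∋ b ∷ []) ⟩
    2 * b ∎)
    where open ≡-Reasoning

  private
    double-offset : ∀ {a b} → Odd M → ∀ k → b < M → b + b ≡ a + a + k * M → a ≡ b
    double-offset {a} {b} _ zero _ eq = +-self-injective (sym (trans eq (+-identityʳ (a + a))))
    double-offset {a} {b} (t , M≡) (suc zero) _ eq = ⊥-elim (even≢odd b (a + t) (begin
      2 * b                   ≡⟨ solve (List ℕ ∋ b ∷ []) ⟩
      b + b                   ≡⟨ eq ⟩
      a + a + 1 * M           ≡⟨ cong (λ m → a + a + 1 * m) M≡ ⟩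
      a + a + 1 * suc (t * 2) ≡⟨ solve (List ℕ ∋ a ∷ t ∷ []) ⟩
      suc (2 * (a + t))       ∎))
      where open ≡-Reasoning
    double-offset {a} {b} _ (suc (suc k)) b<M eq = ⊥-elim (<⇒≱ (+-mono-< b<M b<M) (begin
      M + M                   ≤⟨ m≤n+m (M + M) (a + a + k * M) ⟩
      a + a + k * M + (M + M) ≡⟨ solve (List ℕ ∋ a ∷ k ∷ M ∷ []) ⟩
      a + a + suc (suc k) * M ≡⟨ eq ⟨
      b + b                   ∎))
      where open ≤-Reasoning

  double-injective : ∀ {a b} → Odd M → a < M → b < M → a + a ≈ b + b → a ≡ b
  double-injective M-odd a<M b<M a+a≈b+b with ≈⇒offset a+a≈b+b
  ... | k , inj₁ eq = double-offset M-odd k b<M eq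
  ... | k , inj₂ eq = sym (double-offset M-odd k a<M eq)

module _ {n} {R : Fin n → Fin n → Set} where

  infixr 5 _++ʷ_
  _++ʷ_ : ∀ {u v w k l} → Walk R u v k → Walk R v w l → Walk R u w (k + l)
  here     ++ʷ q = q
  step e p ++ʷ q = step e (p ++ʷ q)

  infixl 5 _▻ʷ_
  _▻ʷ_ : ∀ {u v w k} → Walk R u v k → R v w → Walk R u w (suc k)
  here     ▻ʷ e′ = step e′ here
  step e p ▻ʷ e′ = step e (p ▻ʷ e′)

  reverseʷ : (∀ {a b} → R a b → R b a) → ∀ {u v k} → Walk R u v k → Walk R v u k
  reverseʷ R-sym here       = here
  reverseʷ R-sym (step e p) = reverseʷ R-sym p ▻ʷ R-sym e

  walk? : (∀ u v → Dec (R u v)) → ∀ u v l → Dec (Walk R u v l)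
  walk? R? u v zero with u ≟ v
  ... | yes refl = yes here
  ... | no u≢v   = no λ { here → u≢v refl }
  walk? R? u v (suc l) with any? (λ w → R? u w ×-dec walk? R? w v l)
  ... | yes (w , e , p) = yes (step e p)
  ... | no ∄w           = no λ { (step e p) → ∄w (_ , e , p) }

least : ∀ {p} {P : Pred ℕ p} → U.Decidable P → ∀ {k} → P k → ∃[ l ] P l × (∀ {m} → P m → l ≤ m)
least {P = P} P? {k} pk = search 0 (λ ()) k pk
  where
  search : ∀ b → (∀ {m} → m < b → ¬ P m) → ∀ d → P (b + d) → ∃[ l ] P l × (∀ {m} → P m → l ≤ m)
  search b below d p with P? b
  ... | yes pb = b , pb , λ pm → ≮⇒≥ λ m<b → below m<b pm
  search b below zero    p | no ¬pb = ⊥-elim (¬pb (subst P (+-identityʳ b) p))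
  search b below (suc d) p | no ¬pb = search (suc b) below′ d (subst P (+-suc b d) p)
    where
    below′ : ∀ {m} → m < suc b → ¬ P m
    below′ m<1+b with m<1+n⇒m<n∨m≡n m<1+b
    ... | inj₁ m<b  = below m<b
    ... | inj₂ refl = ¬pb

module Distance {n} (G : Graph n) (connected : Connected G) where

  private
    shortest : ∀ u v → ∃ (Dist G u v)
    shortest u v with least (walk? (adj? G) u v) (proj₂ (connected u v))
    ... | l , p , minimal = l , p , λ _ → minimal

  dist : Fin n → Fin n → ℕ
  dist u v = proj₁ (shortest u v)

  dist-Dist : ∀ u v → Dist G u v (dist u v)
  dist-Dist u v = proj₂ (shortest u v)

  dist-walk : ∀ u v → Walk (Adj G) u v (dist u v)
  dist-walk u v = proj₁ (dist-Dist u v)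

  dist-minimal : ∀ {u v l} → Walk (Adj G) u v l → dist u v ≤ l
  dist-minimal {u} {v} = proj₂ (dist-Dist u v) _

  dist-self : ∀ u → dist u u ≡ 0
  dist-self u = n≤0⇒n≡0 (dist-minimal {u} here)

  Dist⇒≡dist : ∀ {u v a} → Dist G u v a → a ≡ dist u v
  Dist⇒≡dist (p , minimal) = ≤-antisym (minimal _ (dist-walk _ _)) (dist-minimal p)

module CyclicOrder (m : ℕ) where

  open Modular (suc m) public

  next : Fin (suc m) → Fin (suc m)
  next i with suc (toℕ i) <? suc m
  ... | yes i+1<L = fromℕ< i+1<L
  ... | no _      = fzero

  Consec-next : ∀ i → Consec i (next i)
  Consec-next i with suc (toℕ i) <? suc m
  ... | yes i+1<L = inj₁ (toℕ-fromℕ< i+1<L)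
  ... | no i+1≮L  = inj₂ (≤-antisym (≤-pred (toℕ<n i)) (≤-pred (≮⇒≥ i+1≮L)) , refl)

  Consec⇒≈ : ∀ {i j} → Consec i j → suc (toℕ i) ≈ toℕ j
  Consec⇒≈ (inj₁ j≡1+i) = ≈-reflexive (sym j≡1+i)
  Consec⇒≈ {i} {j} (inj₂ (i≡m , j≡0)) = begin
    suc (toℕ i) ≡⟨ cong suc i≡m ⟩
    0 + suc m   ≈⟨ x+M≈x 0 ⟩
    0           ≡⟨ j≡0 ⟨
    toℕ j       ∎
    where open ≈-Reasoning

  toℕ-≈-injective : ∀ {i j : Fin (suc m)} → toℕ i ≈ toℕ j → i ≡ j
  toℕ-≈-injective {i} {j} i≈j = toℕ-injective (≈⇒≡ i≈j (toℕ<n i) (toℕ<n j))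

  shift : ℕ → Fin (suc m) → Fin (suc m)
  shift zero    i = i
  shift (suc k) i = next (shift k i)

  shift-≈ : ∀ k i → toℕ (shift k i) ≈ k + toℕ i
  shift-≈ zero    i = ≈-refl
  shift-≈ (suc k) i = ≈-trans (≈-sym (Consec⇒≈ (Consec-next (shift k i)))) (+-congˡ {1} (shift-≈ k i))

  %-≈ : ∀ x → x % suc m ≈ x
  %-≈ x = x / suc m , 0 , trans (sym (m≡m%n+[m/n]*n x (suc m))) (sym (+-identityʳ x))

  -- fw i j is the number of forward steps from position i to position j. It is
  -- opaque because unfolding _%_ during unification makes checking very slow.
  opaque
    fw : Fin (suc m) → Fin (suc m) → ℕ
    fw i j = (toℕ j + (suc m ∸ toℕ i)) % suc m

    fw<L : ∀ i j → fw i j < suc m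
    fw<L i j = m%n<n (toℕ j + (suc m ∸ toℕ i)) (suc m)

    fw-≈ : ∀ i j → fw i j + toℕ i ≈ toℕ j
    fw-≈ i j = begin
      fw i j + toℕ i                 ≈⟨ +-cong (%-≈ (toℕ j + (suc m ∸ toℕ i))) (≈-refl {toℕ i}) ⟩
      toℕ j + (suc m ∸ toℕ i) + toℕ i ≡⟨ +-assoc (toℕ j) _ _ ⟩
      toℕ j + (suc m ∸ toℕ i + toℕ i) ≡⟨ cong (toℕ j +_) (m∸n+n≡m (<⇒≤ (toℕ<n i))) ⟩
      toℕ j + suc m                   ≈⟨ x+M≈x (toℕ j) ⟩
      toℕ j                           ∎
      where open ≈-Reasoning

  fw-unique : ∀ {t i j} → t < suc m → t + toℕ i ≈ toℕ j → t ≡ fw i j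
  fw-unique {i = i} {j} t<L t+i≈j = ≈⇒≡ (+-cancelʳ (≈-trans t+i≈j (≈-sym (fw-≈ i j)))) t<L (fw<L i j)

  shift-fw : ∀ i j → shift (fw i j) i ≡ j
  shift-fw i j = toℕ-≈-injective (≈-trans (shift-≈ (fw i j) i) (fw-≈ i j))

  fw-shift : ∀ {j} i → j < suc m → fw i (shift j i) ≡ j
  fw-shift {j} i j<L = sym (fw-unique j<L (≈-sym (shift-≈ j i)))

  shift-injective : ∀ {j j′} i → j < suc m → j′ < suc m → shift j i ≡ shift j′ i → j ≡ j′
  shift-injective i j<L j′<L eq = trans (sym (fw-shift i j<L)) (trans (cong (fw i) eq) (fw-shift i j′<L))

  fw-self : ∀ i → fw i i ≡ 0
  fw-self i = sym (fw-unique (s≤s z≤n) ≈-refl)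

  private
    fw-unique′ : ∀ {t i j} → t ≤ suc m → t + toℕ i ≈ toℕ j → t ≡ fw i j ⊎ i ≡ j
    fw-unique′ t≤L t+i≈j with m≤n⇒m<n∨m≡n t≤L
    ... | inj₁ t<L  = inj₁ (fw-unique t<L t+i≈j)
    ... | inj₂ refl = inj₂ (toℕ-≈-injective (≈-trans (≈-sym (L+x≈x _)) t+i≈j))
      where
      L+x≈x : ∀ x → suc m + x ≈ x
      L+x≈x x = ≈-trans (≈-reflexive (+-comm (suc m) x)) (x+M≈x x)

  fw-Consecʳ : ∀ q {a b} → Consec a b → suc (fw q a) ≡ fw q b ⊎ q ≡ b
  fw-Consecʳ q {a} c = fw-unique′ (fw<L q a) (≈-trans (+-congˡ {1} (fw-≈ q a)) (Consec⇒≈ c))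

  fw-Consecˡ : ∀ q {a b} → Consec a b → suc (fw b q) ≡ fw a q ⊎ a ≡ q
  fw-Consecˡ q {a} {b} c = fw-unique′ (fw<L b q) (begin
    suc (fw b q) + toℕ a ≡⟨ +-suc (fw b q) (toℕ a) ⟨
    fw b q + suc (toℕ a) ≈⟨ +-congˡ (Consec⇒≈ c) ⟩
    fw b q + toℕ b       ≈⟨ fw-≈ b q ⟩
    toℕ q                ∎)
    where open ≈-Reasoning

  fw-Consec : ∀ {a b} → Consec a b → fw a b ≤ 1
  fw-Consec {a} c with fw-Consecʳ a c
  ... | inj₁ eq   = ≤-reflexive (trans (sym eq) (cong suc (fw-self a)))
  ... | inj₂ refl = ≤-trans (≤-reflexive (fw-self a)) z≤n

  δ : Fin (suc m) → Fin (suc m) → ℕ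
  δ i j = fw i j ⊓ fw j i

  δ-self : ∀ i → δ i i ≡ 0
  δ-self i = cong (_⊓ fw i i) (fw-self i)

  δ-Consec-≤ : ∀ q {a b} → Consec a b → δ q a ≤ suc (δ q b)
  δ-Consec-≤ q {a} {b} c = ⊓-glb via-qb via-bq
    where
    via-qb : δ q a ≤ suc (fw q b)
    via-qb with fw-Consecʳ q c
    ... | inj₁ eq   = ≤-trans (m⊓n≤m (fw q a) (fw a q)) (≤-trans (n≤1+n _) (≤-trans (≤-reflexive eq) (n≤1+n _)))
    ... | inj₂ refl = ≤-trans (m⊓n≤n (fw q a) (fw a q)) (≤-trans (fw-Consec c) (s≤s z≤n))
    via-bq : δ q a ≤ suc (fw b q)
    via-bq with fw-Consecˡ q c
    ... | inj₁ eq   = ≤-trans (m⊓n≤n (fw q a) (fw a q)) (≤-reflexive (sym eq))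
    ... | inj₂ refl = ≤-trans (≤-reflexive (δ-self a)) z≤n

  δ-Consec-≥ : ∀ q {a b} → Consec a b → δ q b ≤ suc (δ q a)
  δ-Consec-≥ q {a} {b} c = ⊓-glb via-qa via-aq
    where
    via-qa : δ q b ≤ suc (fw q a)
    via-qa with fw-Consecʳ q c
    ... | inj₁ eq   = ≤-trans (m⊓n≤m (fw q b) (fw b q)) (≤-reflexive (sym eq))
    ... | inj₂ refl = ≤-trans (≤-reflexive (δ-self q)) z≤n
    via-aq : δ q b ≤ suc (fw a q)
    via-aq with fw-Consecˡ q c
    ... | inj₁ eq   = ≤-trans (m⊓n≤n (fw q b) (fw b q)) (≤-trans (n≤1+n _) (≤-trans (≤-reflexive eq) (n≤1+n _)))
    ... | inj₂ refl = ≤-trans (m⊓n≤m (fw a b) (fw b a)) (≤-trans (fw-Consec c) (s≤s z≤n))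

  δ-realized : ∀ x a → δ x a + toℕ x ≈ toℕ a ⊎ δ x a + toℕ a ≈ toℕ x
  δ-realized x a with ⊓-sel (fw x a) (fw a x)
  ... | inj₁ δ≡ = inj₁ (subst (λ t → t + toℕ x ≈ toℕ a) (sym δ≡) (fw-≈ x a))
  ... | inj₂ δ≡ = inj₂ (subst (λ t → t + toℕ a ≈ toℕ x) (sym δ≡) (fw-≈ a x))

  δ-equal⇒midpoint : ∀ {x y a} → δ x a ≡ δ y a → x ≢ y → toℕ a + toℕ a ≈ toℕ x + toℕ y
  δ-equal⇒midpoint {x} {y} {a} δx≡δy x≢y =
    ≈-midpoint (δ-realized x a)
               (subst (λ t → t + toℕ y ≈ toℕ a ⊎ t + toℕ a ≈ toℕ y) (sym δx≡δy) (δ-realized y a))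
               (x≢y ∘ toℕ-≈-injective)

module _ {A : Set} where

  lastOf : A → List A → A
  lastOf x []       = x
  lastOf _ (y ∷ ys) = lastOf y ys

  lastOf-++ : ∀ x xs y ys → lastOf x (xs ++ y ∷ ys) ≡ lastOf y ys
  lastOf-++ x []       y ys = refl
  lastOf-++ x (z ∷ xs) y ys = lastOf-++ z xs y ys

  lastOf-∈-∷ : ∀ x ys → lastOf x ys ∈ₗ x ∷ ys
  lastOf-∈-∷ x []       = here refl
  lastOf-∈-∷ x (y ∷ ys) = there (lastOf-∈-∷ y ys)

  lastOf-∈ : ∀ x ys → lastOf x ys ≢ x → lastOf x ys ∈ₗ ys
  lastOf-∈ x []       last≢x = ⊥-elim (last≢x refl)
  lastOf-∈ x (y ∷ ys) _      = lastOf-∈-∷ y ys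

  lastOf-applyUpTo : ∀ (f : ℕ → A) k → lastOf (f 0) (applyUpTo (f ∘ suc) k) ≡ f k
  lastOf-applyUpTo f zero    = refl
  lastOf-applyUpTo f (suc k) = lastOf-applyUpTo (f ∘ suc) k

  lookup-last : ∀ x xs (i : Fin (suc (length xs))) → toℕ i ≡ length xs → lookup (x ∷ xs) i ≡ lastOf x xs
  lookup-last x []       fzero    _   = refl
  lookup-last x (y ∷ ys) (fsuc i) i≡ = lookup-last y ys i (suc-injective i≡)

  module _ {R : A → A → Set} where

    Linked-++⁻ʳ : ∀ xs {ys} → Linked R (xs ++ ys) → Linked R ys
    Linked-++⁻ʳ []       l = l
    Linked-++⁻ʳ (x ∷ xs) l = Linked-++⁻ʳ xs (Linked.tail l)

    Linked-reroute : ∀ xs {y zs ws} → Linked R (xs ++ y ∷ zs) → Linked R (y ∷ ws) → Linked R (xs ++ y ∷ ws)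
    Linked-reroute []            _       l′ = l′
    Linked-reroute (x ∷ [])      (r ∷ _) l′ = r ∷ l′
    Linked-reroute (x ∷ x′ ∷ xs) (r ∷ l) l′ = r ∷ Linked-reroute (x′ ∷ xs) l l′

    Linked-lookup : ∀ {xs} → Linked R xs → ∀ {i j} → toℕ j ≡ suc (toℕ i) → R (lookup xs i) (lookup xs j)
    Linked-lookup (r ∷ l) {fzero}  {fsuc fzero} _   = r
    Linked-lookup (r ∷ l) {fsuc i} {fsuc j}     j≡ = Linked-lookup l (suc-injective j≡)

  any⇒firstView : ∀ {P : Pred A 0ℓ} → U.Decidable P → ∀ {xs} → Any P xs → First.FirstView (U.∁ P) P xs
  any⇒firstView P? = toView ∘ First.refine (λ {x} _ → toSum (P? x)) ∘ First.fromAny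

  Unique-++⁻ˡ : ∀ xs {ys : List A} → Unique (xs ++ ys) → Unique xs
  Unique-++⁻ˡ []       _          = []
  Unique-++⁻ˡ (x ∷ xs) (x∉ ∷ uq) = All.++⁻ˡ xs x∉ ∷ Unique-++⁻ˡ xs uq

  Unique-++⁻ʳ : ∀ xs {ys : List A} → Unique (xs ++ ys) → Unique ys
  Unique-++⁻ʳ []       uq       = uq
  Unique-++⁻ʳ (x ∷ xs) (_ ∷ uq) = Unique-++⁻ʳ xs uq

  Unique-lookup-injective : ∀ {xs : List A} → Unique xs → ∀ {i j} → lookup xs i ≡ lookup xs j → i ≡ j
  Unique-lookup-injective (x∉ ∷ uq) {fzero}  {fzero}  _  = refl
  Unique-lookup-injective (x∉ ∷ uq) {fzero}  {fsuc j} eq = ⊥-elim (All.lookup x∉ (∈-lookup j) eq)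
  Unique-lookup-injective (x∉ ∷ uq) {fsuc i} {fzero}  eq = ⊥-elim (All.lookup x∉ (∈-lookup i) (sym eq))
  Unique-lookup-injective (x∉ ∷ uq) {fsuc i} {fsuc j} eq = cong fsuc (Unique-lookup-injective uq eq)

module _ {n} {R : Fin n → Fin n → Set} where

  open import Data.List.Membership.DecPropositional (_≟_ {n}) using () renaming (_∈?_ to _∈ₗ?_)

  SimplePath : Fin n → Fin n → Set
  SimplePath u v = ∃[ ys ] Linked R (u ∷ ys) × Unique (u ∷ ys) × lastOf u ys ≡ v

  walk⇒simplePath : ∀ {u v k} → Walk R u v k → SimplePath u v
  walk⇒simplePath here = [] , [-] , [] ∷ [] , refl
  walk⇒simplePath {u} (step e w) with walk⇒simplePath w
  ... | ys , linked , unique , last with u ∈ₗ? (_ ∷ ys)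
  ...   | no u∉  = _ ∷ ys , e ∷ linked , ¬Any⇒All¬ _ u∉ ∷ unique , last
  ...   | yes u∈ with ∈-∃++ u∈
  ...     | pre , post , eq =
    post , Linked-++⁻ʳ pre (subst (Linked R) eq linked) , Unique-++⁻ʳ pre (subst Unique eq unique) ,
    trans (sym (lastOf-++ u pre u post)) (trans (cong (lastOf u) (sym eq)) last)

ClosedPath : ∀ {n} → Graph n → Fin n → List (Fin n) → Set
ClosedPath G x xs = Linked (Adj G) (x ∷ xs) × Unique (x ∷ xs) × Adj G (lastOf x xs) x

module _ {n} {G : Graph n} where

  closedPath⇒Cycle : ∀ x xs → 2 ≤ length xs → ClosedPath G x xs → Cycle G
  closedPath⇒Cycle x xs 2≤len (linked , unique , back) = record
    { len-1 = length xs
    ; len≥3 = 2≤len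
    ; vert  = lookup (x ∷ xs)
    ; inj   = Unique-lookup-injective unique
    ; adjC  = adjacent
    }
    where
    adjacent : ∀ i j → Consec i j → Adj G (lookup (x ∷ xs) i) (lookup (x ∷ xs) j)
    adjacent i j        (inj₁ j≡1+i)      = Linked-lookup linked j≡1+i
    adjacent i fzero    (inj₂ (i≡last , _)) = subst (λ z → Adj G z x) (sym (lookup-last x xs i i≡last)) back

  closedPath-firstEdge : ∀ {C : Cycle G} → UniqueCycle C → ∀ x y ys → 1 ≤ length ys →
                         ClosedPath G x (y ∷ ys) → CycleEdge C x y
  closedPath-firstEdge unique-C x y ys 1≤len closed =
    proj₂ (unique-C D x y) (fzero , fsuc fzero , inj₁ refl , inj₁ (refl , refl))
    where
    D : Cycle G
    D = closedPath⇒Cycle x (y ∷ ys) (s≤s 1≤len) closed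

module OnCycle {n} {G : Graph n} (C : Cycle G) where

  open CyclicOrder (len-1 C) public

  arcWalk : ∀ k i → Walk (Adj G) (vert C i) (vert C (shift k i)) k
  arcWalk zero    i = here
  arcWalk (suc k) i = arcWalk k i ▻ʷ adjC C _ _ (Consec-next (shift k i))

  fw-walk : ∀ i j → Walk (Adj G) (vert C i) (vert C j) (fw i j)
  fw-walk i j = subst (λ z → Walk (Adj G) (vert C i) (vert C z) (fw i j)) (shift-fw i j) (arcWalk (fw i j) i)

  δ-walk : ∀ i j → Walk (Adj G) (vert C i) (vert C j) (δ j i)
  δ-walk i j with ⊓-sel (fw j i) (fw i j)
  ... | inj₁ δ≡ = subst (Walk (Adj G) (vert C i) (vert C j)) (sym δ≡) (reverseʷ (symAdj G) (fw-walk j i))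
  ... | inj₂ δ≡ = subst (Walk (Adj G) (vert C i) (vert C j)) (sym δ≡) (fw-walk i j)

  arc : Fin (suc (len-1 C)) → ℕ → List (Fin n)
  arc i k = applyUpTo (λ j → vert C (shift j i)) k

  arc-Linked : ∀ i k → Linked (Adj G) (arc i k)
  arc-Linked i k = Linked.applyUpTo⁺₂ _ k (λ j → adjC C _ _ (Consec-next (shift j i)))

  ∈-arc : ∀ {v i k} → v ∈ₗ arc i k → ∃[ j ] j < k × v ≡ vert C (shift j i)
  ∈-arc = ∈-applyUpTo⁻ _

  arc-Unique : ∀ i k → k ≤ suc (len-1 C) → Unique (arc i k)
  arc-Unique i k k≤L = Unique.applyUpTo⁺₁ _ k λ j<j′ j′<k eq →
    <⇒≢ j<j′ (shift-injective i (<-≤-trans (<-trans j<j′ j′<k) k≤L) (<-≤-trans j′<k k≤L) (inj C eq))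

  Consec⇒CycleEdge : ∀ {i j} → Consec i j → CycleEdge C (vert C i) (vert C j)
  Consec⇒CycleEdge {i} {j} c = i , j , c , inj₁ (refl , refl)

  CycleEdge-sym : ∀ {u v} → CycleEdge C u v → CycleEdge C v u
  CycleEdge-sym (i , j , c , inj₁ (u≡ , v≡)) = i , j , c , inj₂ (v≡ , u≡)
  CycleEdge-sym (i , j , c , inj₂ (u≡ , v≡)) = i , j , c , inj₁ (v≡ , u≡)

  AdjMinusC-sym : ∀ {u v} → AdjMinusC C u v → AdjMinusC C v u
  AdjMinusC-sym (e , ¬cyc) = symAdj G e , ¬cyc ∘ CycleEdge-sym

  shift-fw-pred : ∀ {i m t} → fw m i ≡ suc t → Consec (shift t m) i
  shift-fw-pred {i} {m} {t} fw≡ =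
    subst (Consec (shift t m)) (subst (λ k → shift k m ≡ i) fw≡ (shift-fw m i)) (Consec-next (shift t m))

  arc-closedPath : ∀ {i m t} pre {post} → fw m i ≡ suc t → All (¬_ ∘ OnCycle C) pre →
                   Linked (Adj G) (vert C i ∷ pre ++ vert C m ∷ post) →
                   Unique (vert C i ∷ pre ++ vert C m ∷ post) →
                   ClosedPath G (vert C i) (pre ++ arc m (suc t))
  arc-closedPath {i} {m} {t} pre fw≡ off linked unique =
    Linked-reroute (vert C i ∷ pre) linked (arc-Linked m (suc t)) ,
    Unique.++⁺ (Unique-++⁻ˡ (vert C i ∷ pre) unique) (arc-Unique m (suc t) 1+t≤L) disjoint ,
    subst (λ z → Adj G z (vert C i)) (sym last≡) (adjC C _ _ (shift-fw-pred fw≡))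
    where
    1+t≤L : suc t ≤ suc (len-1 C)
    1+t≤L = subst (_≤ suc (len-1 C)) fw≡ (<⇒≤ (fw<L m i))
    last≡ : lastOf (vert C i) (pre ++ arc m (suc t)) ≡ vert C (shift t m)
    last≡ = trans (lastOf-++ (vert C i) pre (vert C m) _) (lastOf-applyUpTo (λ j → vert C (shift j m)) t)
    disjoint : Disjoint (vert C i ∷ pre) (arc m (suc t))
    disjoint (v∈ , v∈arc) with ∈-arc v∈arc
    ... | j , j<1+t , refl with v∈
    ...   | here eq    =
      <⇒≢ j<1+t (trans (sym (fw-shift m (<-≤-trans j<1+t 1+t≤L))) (trans (cong (fw m) (inj C eq)) fw≡))
    ...   | there v∈pre = All.lookup off v∈pre (shift j m , refl)

  consec? : ∀ (i j : Fin (suc (len-1 C))) → Dec (Consec i j)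
  consec? i j = (toℕ j ≟ℕ suc (toℕ i)) ⊎-dec ((toℕ i ≟ℕ len-1 C) ×-dec (toℕ j ≟ℕ 0))

  cycleEdge? : ∀ u v → Dec (CycleEdge C u v)
  cycleEdge? u v = any? λ i → any? λ j →
    consec? i j ×-dec ((u ≟ vert C i ×-dec v ≟ vert C j) ⊎-dec (u ≟ vert C j ×-dec v ≟ vert C i))

  onCycle? : ∀ v → Dec (OnCycle C v)
  onCycle? v = any? λ i → v ≟ vert C i

  module _ (unique-C : UniqueCycle C) where

    private
      detour-firstEdge : ∀ {i m} pre {post} t → fw m i ≡ suc t →
                         Linked (AdjMinusC C) (vert C i ∷ pre ++ vert C m ∷ post) →
                         ClosedPath G (vert C i) (pre ++ arc m (suc t)) → ⊥
      detour-firstEdge []        zero    fw≡ (e ∷ _) _      =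
        proj₂ e (CycleEdge-sym (Consec⇒CycleEdge (shift-fw-pred fw≡)))
      detour-firstEdge []        (suc t) fw≡ (e ∷ _) closed =
        proj₂ e (closedPath-firstEdge {C = C} unique-C _ _ _ (s≤s z≤n) closed)
      detour-firstEdge (p ∷ pre) t       fw≡ (e ∷ _) closed =
        proj₂ e (closedPath-firstEdge {C = C} unique-C _ _ _ (∈-length (∈-++⁺ʳ pre (here refl))) closed)

    -- pre is a detour from c_i, off the cycle, back to c_m; closed up by the arc
    -- of C from c_m to c_i it forms a cycle whose first edge is outside E(C).
    detour-absurd : ∀ i m pre {post} → All (¬_ ∘ OnCycle C) pre →
                    Linked (AdjMinusC C) (vert C i ∷ pre ++ vert C m ∷ post) →
                    Unique (vert C i ∷ pre ++ vert C m ∷ post) → ⊥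
    detour-absurd i m pre off linked unique with fw m i in fw≡
    detour-absurd i m pre off linked (i∉ ∷ _) | zero =
      All.lookup i∉ (∈-++⁺ʳ pre (here refl)) (cong (vert C) (sym m≡i))
      where
      m≡i : m ≡ i
      m≡i = subst (λ k → shift k m ≡ i) fw≡ (shift-fw m i)
    ... | suc t = detour-firstEdge pre t fw≡ linked (arc-closedPath pre fw≡ off (Linked.map proj₁ linked) unique)

    InT-cycle⇒≡ : ∀ {i j} → InT C (vert C i) (vert C j) → i ≡ j
    InT-cycle⇒≡ {i} {j} (_ , w) with i ≟ j
    ... | yes i≡j = i≡j
    ... | no i≢j with walk⇒simplePath w
    ...   | ys , linked , unique , last with any⇒firstView onCycle? (lose j∈ys (j , refl))
      where
      j∈ys : vert C j ∈ₗ ys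
      j∈ys = subst (_∈ₗ ys) last (lastOf-∈ (vert C i) ys λ last≡i → i≢j (inj C (trans (sym last≡i) last)))
    ...     | First._++_∷_ off (m , refl) _ = ⊥-elim (detour-absurd i m _ off linked unique)

module Trees {n} {G : Graph n} (connected : Connected G) (C : Cycle G) (unique-C : UniqueCycle C) where

  open OnCycle C public
  open Distance G connected public

  InT-refl : ∀ {u} → InT C u u
  InT-refl = 0 , here

  InT-extend : ∀ {u v w} → InT C u v → AdjMinusC C v w → InT C u w
  InT-extend (k , p) e = suc k , p ▻ʷ e

  InT-unique : ∀ {i j v} → InT C (vert C i) v → InT C (vert C j) v → i ≡ j
  InT-unique (k , p) (l , q) = InT-cycle⇒≡ unique-C (k + l , p ++ʷ reverseʷ AdjMinusC-sym q)

  CycleEdge⇒OnCycle : ∀ {u v} → CycleEdge C u v → OnCycle C u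
  CycleEdge⇒OnCycle (i , j , _ , inj₁ (u≡ , _)) = i , u≡
  CycleEdge⇒OnCycle (i , j , _ , inj₂ (u≡ , _)) = j , u≡

  root-walk : ∀ {v w k} → Walk (Adj G) v w k → OnCycle C w → ∃[ i ] InT C (vert C i) v
  root-walk here (i , refl) = i , InT-refl
  root-walk {v} (step e w) onC with onCycle? v
  ... | yes (i , refl) = i , InT-refl
  ... | no v-off with root-walk w onC
  ...   | i , w∈Tᵢ = i , InT-extend w∈Tᵢ (AdjMinusC-sym (e , v-off ∘ CycleEdge⇒OnCycle))

  root : Fin n → Fin (suc (len-1 C))
  root v = proj₁ (root-walk (proj₂ (connected v (vert C fzero))) (fzero , refl))

  InT-root : ∀ v → InT C (vert C (root v)) v
  InT-root v = proj₂ (root-walk (proj₂ (connected v (vert C fzero))) (fzero , refl))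

  edge-roots : ∀ {v w i j} → Adj G v w → InT C (vert C i) v → InT C (vert C j) w →
               i ≡ j ⊎ (v ≡ vert C i × (Consec i j ⊎ Consec j i))
  edge-roots {v} {w} e v∈Tᵢ w∈Tⱼ with cycleEdge? v w
  ... | no ¬cyc = inj₁ (InT-unique v∈Tᵢ (InT-extend w∈Tⱼ (AdjMinusC-sym (e , ¬cyc))))
  ... | yes (_ , _ , c , inj₁ (refl , refl)) with InT-unique v∈Tᵢ InT-refl | InT-unique w∈Tⱼ InT-refl
  ...   | refl | refl = inj₂ (refl , inj₁ c)
  edge-roots e v∈Tᵢ w∈Tⱼ | yes (_ , _ , c , inj₂ (refl , refl)) with InT-unique v∈Tᵢ InT-refl | InT-unique w∈Tⱼ InT-refl
  ...   | refl | refl = inj₂ (refl , inj₂ c)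

  δ-lower : ∀ {v w l p q} → Walk (Adj G) v w l → InT C (vert C p) v → InT C (vert C q) w → δ q p ≤ l
  δ-lower {q = q} here p∈ q∈ = ≤-reflexive (trans (cong (δ q) (InT-unique p∈ q∈)) (δ-self q))
  δ-lower {q = q} (step {v = v′} e w) p∈ q∈ with edge-roots e p∈ (InT-root v′)
  ... | inj₁ refl         = m≤n⇒m≤1+n (δ-lower w (InT-root v′) q∈)
  ... | inj₂ (_ , inj₁ c) = ≤-trans (δ-Consec-≤ q c) (s≤s (δ-lower w (InT-root v′) q∈))
  ... | inj₂ (_ , inj₂ c) = ≤-trans (δ-Consec-≥ q c) (s≤s (δ-lower w (InT-root v′) q∈))

  dist-lower : ∀ {v j l a} → Walk (Adj G) v (vert C j) l → InT C (vert C a) v → dist v (vert C a) + δ j a ≤ l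
  dist-lower {a = a} here a∈ with InT-cycle⇒≡ unique-C a∈
  ... | refl = ≤-reflexive (cong₂ _+_ (dist-self (vert C a)) (δ-self a))
  dist-lower {j = j} {suc l} {a} (step {v = v′} e w) a∈ with edge-roots e a∈ (InT-root v′)
  ... | inj₁ refl       =
    ≤-trans (+-monoˡ-≤ (δ j a) (dist-minimal (step e (dist-walk v′ (vert C a))))) (s≤s (dist-lower w (InT-root v′)))
  ... | inj₂ (refl , _) =
    subst (λ d → d + δ j a ≤ suc l) (sym (dist-self (vert C a))) (δ-lower (step e w) a∈ InT-refl)

  dist-via-root : ∀ {s a} j → InT C (vert C a) s → dist s (vert C j) ≡ dist s (vert C a) + δ j a
  dist-via-root {s} {a} j a∈ =
    sym (Dist⇒≡dist (dist-walk s (vert C a) ++ʷ δ-walk a j , λ _ w → dist-lower w a∈))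

  equidistant⇒midpoint : ∀ {s a i j} → InT C (vert C a) s → dist s (vert C i) ≡ dist s (vert C j) → i ≢ j →
                         toℕ a + toℕ a ≈ toℕ i + toℕ j
  equidistant⇒midpoint {s} {a} {i} {j} a∈ d≡ i≢j = δ-equal⇒midpoint (+-cancelˡ-≡ (dist s (vert C a)) _ _ (begin
    dist s (vert C a) + δ i a ≡⟨ dist-via-root i a∈ ⟨
    dist s (vert C i)         ≡⟨ d≡ ⟩
    dist s (vert C j)         ≡⟨ dist-via-root j a∈ ⟩
    dist s (vert C a) + δ j a ∎)) i≢j
    where open ≡-Reasoning

  unresolved⇒oneTree : Odd (suc (len-1 C)) → ∀ {i j} → i ≢ j → (S : Subset n) →
                       (∀ s → s ∈ S → dist s (vert C i) ≡ dist s (vert C j)) →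
                       ∃[ a ] ∀ s → s ∈ S → InT C (vert C a) s
  unresolved⇒oneTree odd i≢j S equidistant with any? (_∈? S)
  ... | no ∄s          = fzero , λ s s∈S → ⊥-elim (∄s (s , s∈S))
  ... | yes (s₀ , s₀∈S) =
    root s₀ , λ s s∈S → subst (λ a → InT C (vert C a) s) (same-root s∈S) (InT-root s)
    where
    same-root : ∀ {s} → s ∈ S → root s ≡ root s₀
    same-root {s} s∈S = toℕ-injective (double-injective odd (toℕ<n _) (toℕ<n _) (≈-trans
      (equidistant⇒midpoint (InT-root s) (equidistant s s∈S) i≢j)
      (≈-sym (equidistant⇒midpoint (InT-root s₀) (equidistant s₀ s₀∈S) i≢j))))

  resolving : Odd (suc (len-1 C)) → (S : Subset n) → (∀ a → ¬ (∀ s → s ∈ S → InT C (vert C a) s)) →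
              ∀ {i j} → i ≢ j →
              ∃[ s ] ∃[ d ] ∃[ d′ ] (s ∈ S × Dist G s (vert C i) d × Dist G s (vert C j) d′ × d ≢ d′)
  resolving odd S spread {i} {j} i≢j
    with any? (λ s → s ∈? S ×-dec ¬? (dist s (vert C i) ≟ℕ dist s (vert C j)))
  ... | yes (s , s∈S , d≢d′) = s , _ , _ , s∈S , dist-Dist s (vert C i) , dist-Dist s (vert C j) , d≢d′
  ... | no ∄s = ⊥-elim (spread _ (proj₂ (unresolved⇒oneTree odd i≢j S equidistant)))
    where
    equidistant : ∀ s → s ∈ S → dist s (vert C i) ≡ dist s (vert C j)
    equidistant s s∈S = decidable-stable (_ ≟ℕ _) λ d≢d′ → ∄s (s , s∈S , d≢d′)

lemma27 : ∀ {n} (G : Graph n) → Connected G → (C : Cycle G) → UniqueCycle C → Odd (cycleLength C) →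
    (S : Subset n) → (∀ u → OnCycle C u → ¬ (∀ s → s ∈ S → InT C u s)) →
    ∀ x y → OnCycle C x → OnCycle C y → x ≢ y →
    ∃[ s ] ∃[ a ] ∃[ b ] (s ∈ S × Dist G s x a × Dist G s y b × a ≢ b)
lemma27 G connected C unique-C odd S spread _ _ (i , refl) (j , refl) x≢y =
  resolving odd S (λ a → spread (vert C a) (a , refl)) (x≢y ∘ cong (vert C))
  where open Trees connected C unique-C
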